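{- Let $L$ be a matroid on $S\cup T$, where $S\cap T=\emptyset$. Then $L=L|S\mathbin{\Box} L/S$ if and only if $S$ is a free separator of $L$.
   Context: $L|S$ is the restriction of $L$ to $S$ and $L/S$ the contraction of $S$ (a matroid on $T$). For a matroid $M$ on $S$, $\rho(M)$ is its rank, $\nu_M(A)=|A|-\rho_M(A)$ and $\lambda_M(A)=\rho(M)-\rho_M(A)$. For matroids $M$ on $S$ and $N$ on $T$ with $S\cap T=\emptyset$, the free product $M\mathbin{\Box} N$ is the matroid on $S\cup T$ whose independent sets are the $A\subseteq S\cup T$ with $A\cap S$ independent in $M$ and $\lambda_M(A\cap S)\geq\nu_N(A\cap T)$. A cyclic flat is a flat that is a union of circuits. A subset $X$ of the ground set of $L$ is a free separator of $L$ if every cyclic flat of $L$ is comparable to $X$ under inclusion. -}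

module Defs where

open import Data.Nat using (ℕ; zero; suc; _∸_; _≤_; _<_; _⊔_)
open import Data.Bool using (Bool; true; false; _∧_; if_then_else_)
open import Data.Vec using (_∷_; [])
open import Data.List using (List; []; _∷_; map; _++_; foldr)
open import Data.Fin using (Fin)
open import Data.Fin.Subset using (Subset; _∈_; _∉_; _⊆_; _∩_; _∪_; _─_; ⁅_⁆; ∣_∣; ⊥; inside; outside)
open import Data.Fin.Subset.Properties using (_⊆?_)
open import Data.Product using (Σ; ∃; _×_; _,_)
open import Data.Sum using (_⊎_)
open import Relation.Nullary using (¬_; yes; no)
open import Relation.Nullary.Decidable using (⌊_⌋)
open import Relation.Binary.PropositionalEquality using (_≡_)

allSubsets : (n : ℕ) → List (Subset n)
allSubsets zero = [] ∷ []
allSubsets (suc n) = map (outside ∷_) (allSubsets n) ++ map (inside ∷_) (allSubsets n)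

record SetSystem (n : ℕ) : Set where
  field
    ground : Subset n
    indep  : Subset n → Bool
open SetSystem public

Indep : ∀ {n} → SetSystem n → Subset n → Set
Indep M A = indep M A ≡ true

record IsMatroid {n : ℕ} (M : SetSystem n) : Set where
  field
    indep⊆ground : ∀ A → Indep M A → A ⊆ ground M
    indep-empty  : Indep M ⊥
    indep-hered  : ∀ A B → B ⊆ A → Indep M A → Indep M B
    indep-aug    : ∀ A B → Indep M A → Indep M B → ∣ A ∣ < ∣ B ∣ →
                   ∃ λ x → x ∈ B × x ∉ A × Indep M (A ∪ ⁅ x ⁆)

Matroid : ℕ → Set
Matroid n = Σ (SetSystem n) IsMatroid

rank : ∀ {n} → SetSystem n → Subset n → ℕ
rank {n} M A = foldr (λ B r → if ⌊ B ⊆? A ⌋ ∧ indep M B then ∣ B ∣ ⊔ r else r) 0 (allSubsets n)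

rankM : ∀ {n} → SetSystem n → ℕ
rankM M = rank M (ground M)

nullity : ∀ {n} → SetSystem n → Subset n → ℕ
nullity M A = ∣ A ∣ ∸ rank M A

lam : ∀ {n} → SetSystem n → Subset n → ℕ
lam M A = rankM M ∸ rank M A

restrict : ∀ {n} → SetSystem n → Subset n → SetSystem n
restrict L S = record
  { ground = S
  ; indep  = λ A → ⌊ A ⊆? S ⌋ ∧ indep L A }

-- Contraction L/S: ground E(L) ─ S, with rank function
-- ρ_{L/S}(A) = ρ_L(A ∪ S) - ρ_L(S); independent sets are those A with ρ_{L/S}(A) = |A|.
contract : ∀ {n} → SetSystem n → Subset n → SetSystem n
contract L S = record
  { ground = ground L ─ S
  ; indep  = λ A → ⌊ A ⊆? (ground L ─ S) ⌋ ∧ ⌊ (rank L (A ∪ S) ∸ rank L S) Data.Nat.≟ ∣ A ∣ ⌋ }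

freeProduct : ∀ {n} → SetSystem n → SetSystem n → SetSystem n
freeProduct M N = record
  { ground = ground M ∪ ground N
  ; indep  = λ A → ⌊ A ⊆? (ground M ∪ ground N) ⌋ ∧ indep M (A ∩ ground M)
                   ∧ ⌊ nullity N (A ∩ ground N) Data.Nat.≤? lam M (A ∩ ground M) ⌋ }

SameMatroid : ∀ {n} → SetSystem n → SetSystem n → Set
SameMatroid M N = ground M ≡ ground N × (∀ A → indep M A ≡ indep N A)

IsCircuit : ∀ {n} → SetSystem n → Subset n → Set
IsCircuit M C = C ⊆ ground M × ¬ Indep M C × (∀ x → x ∈ C → Indep M (C ─ ⁅ x ⁆))

IsFlat : ∀ {n} → SetSystem n → Subset n → Set
IsFlat M X = X ⊆ ground M × (∀ e → e ∈ ground M → e ∉ X → rank M X < rank M (X ∪ ⁅ e ⁆))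

IsCyclicFlat : ∀ {n} → SetSystem n → Subset n → Set
IsCyclicFlat M X = IsFlat M X × (∀ x → x ∈ X → ∃ λ C → IsCircuit M C × x ∈ C × C ⊆ X)

IsFreeSeparator : ∀ {n} → SetSystem n → Subset n → Set
IsFreeSeparator L X = X ⊆ ground L × (∀ F → IsCyclicFlat L F → F ⊆ X ⊎ X ⊆ F)

-- Since λ_{L|S}(A ∩ S) = ρ(S) − |A ∩ S| for independent A ∩ S and
-- ν_{L/S}(A ∩ T) = |A ∩ T| − ρ((A ∩ T) ∪ S) + ρ(S), a set A is independent in L|S □ L/S iff
-- A ∩ S is independent in L and |A| ≤ ρ((A ∩ T) ∪ S); every L-independent set qualifies.
-- If S is a free separator and such an A contains a circuit C, the cyclic flat cl(C) is
-- comparable with S: cl(C) ⊆ S contradicts independence of A ∩ S, and S ⊆ cl(C) ⊆ cl(A)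
-- gives ρ(A) = ρ(A ∪ S) ≥ |A|. Conversely, if a cyclic flat F is incomparable with S, pick
-- f ∈ F − S, e ∈ S − F and a circuit C ∋ f inside F. As F is a flat, (C − f) ∪ e is
-- independent, so |C| ≤ ρ((C ∩ T) ∪ S) and the L-dependent C is independent in L|S □ L/S.

{-# OPTIONS --safe #-}
module Submission where

open import Defs
open import Data.Nat using (ℕ; zero; suc; _+_; _∸_; _≤_; _<_; _⊔_; z≤n; _≤?_; _<?_; _≟_)
open import Data.Nat.Properties
open import Algebra.Properties.CommutativeSemigroup +-commutativeSemigroup using (x∙yz≈y∙xz)
open import Data.Bool using (Bool; true; false; _∧_; if_then_else_)
open import Data.Bool.Properties using (⇔→≡)
import Data.Bool as Bool
open import Data.Vec using (_∷_; []; tabulate; here; there)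
open import Data.Vec.Properties using (lookup∘tabulate; []=⇒lookup; lookup⇒[]=)
open import Data.List using ([]; _∷_; foldr; map)
open import Data.List.Membership.Propositional using () renaming (_∈_ to _∈ₗ_)
open import Data.List.Membership.Propositional.Properties using (∈-++⁺ˡ; ∈-++⁺ʳ; ∈-map⁺)
import Data.List.Relation.Unary.Any as Any
open import Data.Fin using (Fin; zero; suc)
open import Data.Fin.Properties using (any?)
open import Data.Fin.Subset
open import Data.Fin.Subset.Properties
open import Data.Product using (∃; _×_; _,_; proj₁; proj₂)
open import Data.Product.Function.NonDependent.Propositional using (_×-⇔_)
open import Data.Sum using (_⊎_; inj₁; inj₂)
import Data.Empty as Empty
open import Function using (id; _∘_)
open import Function.Bundles using (_⇔_; mk⇔; Equivalence)
import Function.Properties.Equivalence as ⇔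
open import Relation.Nullary using (¬_; yes; no; Dec; contradiction)
open import Relation.Nullary.Decidable using (⌊_⌋; _×-dec_; ¬?; decidable-stable)
open import Relation.Binary.PropositionalEquality using (_≡_; refl; sym; trans; cong; cong₂; subst)

open Equivalence using (to; from)

∧≡true⇔ : ∀ {a b} → a ∧ b ≡ true ⇔ (a ≡ true × b ≡ true)
∧≡true⇔ {true}  = mk⇔ (refl ,_) proj₂
∧≡true⇔ {false} = mk⇔ (λ ()) (λ ())

⌊⌋≡true⇔ : ∀ {p} {P : Set p} (P? : Dec P) → ⌊ P? ⌋ ≡ true ⇔ P
⌊⌋≡true⇔ (yes p) = mk⇔ (λ _ → p) (λ _ → refl)
⌊⌋≡true⇔ (no ¬p) = mk⇔ (λ ()) (λ p → contradiction p ¬p)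

private variable n : ℕ

x∈p─q⇒x∉q : ∀ (p q : Subset n) {x} → x ∈ p ─ q → x ∉ q
x∈p─q⇒x∉q (_ ∷ p) (inside ∷ q) ()        here
x∈p─q⇒x∉q (_ ∷ p) (_      ∷ q) (there m) (there m′) = x∈p─q⇒x∉q p q m m′

x∈tabulate⇔ : ∀ {f : Fin n → Bool} {x} → x ∈ tabulate f ⇔ f x ≡ true
x∈tabulate⇔ {f = f} {x} = mk⇔
  (λ m → trans (sym (lookup∘tabulate f x)) ([]=⇒lookup m))
  (λ fx → lookup⇒[]= x (tabulate f) (trans (lookup∘tabulate f x) fx))

∪-lub : ∀ {p q r : Subset n} → p ⊆ r → q ⊆ r → p ∪ q ⊆ r
∪-lub {p = p} {q} p⊆r q⊆r m with x∈p∪q⁻ p q m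
... | inj₁ x∈p = p⊆r x∈p
... | inj₂ x∈q = q⊆r x∈q

∪-mono : ∀ {p p′ q q′ : Subset n} → p ⊆ p′ → q ⊆ q′ → p ∪ q ⊆ p′ ∪ q′
∪-mono {p′ = p′} {q′ = q′} p⊆p′ q⊆q′ =
  ∪-lub (p⊆p∪q q′ ∘ p⊆p′) (q⊆p∪q p′ q′ ∘ q⊆q′)

x∈p⇒⁅x⁆⊆p : ∀ {x} {p : Subset n} → x ∈ p → ⁅ x ⁆ ⊆ p
x∈p⇒⁅x⁆⊆p {x = x} x∈p y∈⁅x⁆ = subst (_∈ _) (sym (x∈⁅y⁆⇒x≡y x y∈⁅x⁆)) x∈p

x∈p⇒p∪⁅x⁆≡p : ∀ {x} {p : Subset n} → x ∈ p → p ∪ ⁅ x ⁆ ≡ p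
x∈p⇒p∪⁅x⁆≡p {x = x} x∈p = ⊆-antisym (∪-lub id (x∈p⇒⁅x⁆⊆p x∈p)) (p⊆p∪q ⁅ x ⁆)

p⊆p─q∪q : ∀ (p q : Subset n) → p ⊆ (p ─ q) ∪ q
p⊆p─q∪q p q {x} x∈p with x ∈? q
... | yes x∈q = q⊆p∪q (p ─ q) q x∈q
... | no  x∉q = p⊆p∪q q (x∈p∧x∉q⇒x∈p─q x∈p x∉q)

p⊆r⇒p─q≡p∩[r─q] : ∀ {p r : Subset n} (q : Subset n) → p ⊆ r → p ─ q ≡ p ∩ (r ─ q)
p⊆r⇒p─q≡p∩[r─q] {p = p} {r} q p⊆r = ⊆-antisym
  (λ m → x∈p∩q⁺ (p─q⊆p p q m , x∈p∧x∉q⇒x∈p─q (p⊆r (p─q⊆p p q m)) (x∈p─q⇒x∉q p q m)))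
  (λ m → let x∈p , x∈r─q = x∈p∩q⁻ p (r ─ q) m in x∈p∧x∉q⇒x∈p─q x∈p (x∈p─q⇒x∉q r q x∈r─q))

p⊆r⇒p⊆p∩[r─q]∪q : ∀ {p r : Subset n} (q : Subset n) → p ⊆ r → p ⊆ p ∩ (r ─ q) ∪ q
p⊆r⇒p⊆p∩[r─q]∪q {p = p} q p⊆r rewrite sym (p⊆r⇒p─q≡p∩[r─q] q p⊆r) = p⊆p─q∪q p q

p⊆r⇒p∪[r─p]≡r : ∀ {p r : Subset n} → p ⊆ r → p ∪ (r ─ p) ≡ r
p⊆r⇒p∪[r─p]≡r {p = p} {r} p⊆r =
  ⊆-antisym (∪-lub p⊆r (p─q⊆p r p)) (λ {x} x∈r → ∪-comm-⊆ (p⊆p─q∪q r p x∈r))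
  where
  ∪-comm-⊆ : (r ─ p) ∪ p ⊆ p ∪ (r ─ p)
  ∪-comm-⊆ = ∪-lub (q⊆p∪q p (r ─ p)) (p⊆p∪q (r ─ p))

∣p∪⁅x⁆∣≡1+∣p∣ : ∀ (p : Subset n) {x} → x ∉ p → ∣ p ∪ ⁅ x ⁆ ∣ ≡ suc ∣ p ∣
∣p∪⁅x⁆∣≡1+∣p∣ (inside  ∷ p) {zero}  x∉p = contradiction here x∉p
∣p∪⁅x⁆∣≡1+∣p∣ (outside ∷ p) {zero}  x∉p = cong (suc ∘ ∣_∣) (∪-identityʳ p)
∣p∪⁅x⁆∣≡1+∣p∣ (inside  ∷ p) {suc x} x∉p = cong suc (∣p∪⁅x⁆∣≡1+∣p∣ p (x∉p ∘ there))
∣p∪⁅x⁆∣≡1+∣p∣ (outside ∷ p) {suc x} x∉p = ∣p∪⁅x⁆∣≡1+∣p∣ p (x∉p ∘ there)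

p⊆q∪r⇒p─r⊆q : ∀ {p q r : Subset n} → p ⊆ q ∪ r → p ─ r ⊆ q
p⊆q∪r⇒p─r⊆q {p = p} {q} {r} p⊆q∪r x∈p─r with x∈p∪q⁻ q r (p⊆q∪r (p─q⊆p p r x∈p─r))
... | inj₁ x∈q = x∈q
... | inj₂ x∈r = contradiction x∈r (x∈p─q⇒x∉q p r x∈p─r)

p⊆q∪⁅x⁆∧x∉p⇒p⊆q : ∀ {p q : Subset n} {x} → p ⊆ q ∪ ⁅ x ⁆ → x ∉ p → p ⊆ q
p⊆q∪⁅x⁆∧x∉p⇒p⊆q {p = p} {q} {x} p⊆q∪⁅x⁆ x∉p y∈p with x∈p∪q⁻ q ⁅ x ⁆ (p⊆q∪⁅x⁆ y∈p)
... | inj₁ y∈q = y∈q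
... | inj₂ y∈⁅x⁆ = contradiction (subst (_∈ p) (x∈⁅y⁆⇒x≡y x y∈⁅x⁆) y∈p) x∉p

∣p∣≡1+∣p-x∣ : ∀ (p : Subset n) {x} → x ∈ p → ∣ p ∣ ≡ suc ∣ p - x ∣
∣p∣≡1+∣p-x∣ (inside  ∷ p) here      = cong suc (sym (cong ∣_∣ (p─⊥≡p p)))
∣p∣≡1+∣p-x∣ (inside  ∷ p) (there m) = cong suc (∣p∣≡1+∣p-x∣ p m)
∣p∣≡1+∣p-x∣ (outside ∷ p) (there m) = ∣p∣≡1+∣p-x∣ p m

∣p∣≡∣p∩q∣+∣p─q∣ : ∀ (p q : Subset n) → ∣ p ∣ ≡ ∣ p ∩ q ∣ + ∣ p ─ q ∣
∣p∣≡∣p∩q∣+∣p─q∣ []            []            = refl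
∣p∣≡∣p∩q∣+∣p─q∣ (inside  ∷ p) (inside  ∷ q) = cong suc (∣p∣≡∣p∩q∣+∣p─q∣ p q)
∣p∣≡∣p∩q∣+∣p─q∣ (inside  ∷ p) (outside ∷ q) =
  trans (cong suc (∣p∣≡∣p∩q∣+∣p─q∣ p q)) (sym (+-suc ∣ p ∩ q ∣ ∣ p ─ q ∣))
∣p∣≡∣p∩q∣+∣p─q∣ (outside ∷ p) (inside  ∷ q) = ∣p∣≡∣p∩q∣+∣p─q∣ p q
∣p∣≡∣p∩q∣+∣p─q∣ (outside ∷ p) (outside ∷ q) = ∣p∣≡∣p∩q∣+∣p─q∣ p q

p⊆q∧∣q∣≤∣p∣⇒q⊆p : ∀ {p q : Subset n} → p ⊆ q → ∣ q ∣ ≤ ∣ p ∣ → q ⊆ p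
p⊆q∧∣q∣≤∣p∣⇒q⊆p {p = p} {q} p⊆q ∣q∣≤∣p∣ {x} x∈q with x ∈? p
... | yes x∈p = x∈p
... | no  x∉p = contradiction ∣q∣≤∣p∣ (<⇒≱ (≤-<-trans (p⊆q⇒∣p∣≤∣q∣ p⊆q-x) (x∈p⇒∣p-x∣<∣p∣ x∈q)))
  where
  p⊆q-x : p ⊆ q - x
  p⊆q-x {y} y∈p = x∈p∧x≢y⇒x∈p-y (p⊆q y∈p) (λ { refl → x∉p y∈p })

p⊆q⊎q⊆p : ∀ {p q : Subset n} → (∀ {x y} → x ∈ p → x ∉ q → y ∈ q → y ∉ p → Empty.⊥) →
           p ⊆ q ⊎ q ⊆ p
p⊆q⊎q⊆p {p = p} {q} no-crossing with p ⊆? q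
... | yes p⊆q = inj₁ p⊆q
... | no  p⊈q = inj₂ λ {y} y∈q → decidable-stable (y ∈? p) λ y∉p →
  p⊈q λ {x} x∈p → decidable-stable (x ∈? q) λ x∉q → no-crossing x∈p x∉q y∈q y∉p

∸≤∸⇔+≤+ : ∀ {a b c s} → a ≤ s → b ∸ c ≤ s ∸ a ⇔ a + b ≤ c + s
∸≤∸⇔+≤+ {a} {b} {c} {s} a≤s = mk⇔
  (λ b∸c≤s∸a → ≤-trans (+-monoʳ-≤ a (≤-trans (m≤n+m∸n b c) (+-monoʳ-≤ c b∸c≤s∸a)))
                        (≤-reflexive (sym c+s≡a+[c+[s∸a]])))
  (λ a+b≤c+s → m≤n+o⇒m∸n≤o b c (+-cancelˡ-≤ a b _ (≤-trans a+b≤c+s (≤-reflexive c+s≡a+[c+[s∸a]]))))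
  where
  c+s≡a+[c+[s∸a]] : c + s ≡ a + (c + (s ∸ a))
  c+s≡a+[c+[s∸a]] = trans (cong (c +_) (sym (m+[n∸m]≡n a≤s))) (x∙yz≈y∙xz c a (s ∸ a))

indep? : ∀ (M : SetSystem n) A → Dec (Indep M A)
indep? M A = indep M A Bool.≟ true

IsBasis : SetSystem n → Subset n → Subset n → Set
IsBasis M X B = B ⊆ X × Indep M B × ∣ B ∣ ≡ rank M X

IsCyclic : SetSystem n → Subset n → Set
IsCyclic M X = ∀ x → x ∈ X → ∃ λ C → IsCircuit M C × x ∈ C × C ⊆ X

∈allSubsets : ∀ n (B : Subset n) → B ∈ₗ allSubsets n
∈allSubsets zero    []            = Any.here refl
∈allSubsets (suc n) (outside ∷ B) = ∈-++⁺ˡ (∈-map⁺ (outside ∷_) (∈allSubsets n B))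
∈allSubsets (suc n) (inside  ∷ B) =
  ∈-++⁺ʳ (map (outside ∷_) (allSubsets n)) (∈-map⁺ (inside ∷_) (∈allSubsets n B))

module _ (M : SetSystem n) (A : Subset n) where

  private
    step : Subset n → ℕ → ℕ
    step B r = if ⌊ B ⊆? A ⌋ ∧ indep M B then ∣ B ∣ ⊔ r else r

    foldr-bound : ∀ xs {B} → B ∈ₗ xs → B ⊆ A → Indep M B → ∣ B ∣ ≤ foldr step 0 xs
    foldr-bound (B ∷ xs) (Any.here refl) B⊆A B-indep with B ⊆? A
    ... | no  B⊈A = Empty.⊥-elim (B⊈A B⊆A)
    ... | yes _ rewrite B-indep = m≤m⊔n _ _
    foldr-bound (B′ ∷ xs) (Any.there B∈xs) B⊆A B-indep with ⌊ B′ ⊆? A ⌋ ∧ indep M B′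
    ... | true  = ≤-trans (foldr-bound xs B∈xs B⊆A B-indep) (m≤n⊔m _ _)
    ... | false = foldr-bound xs B∈xs B⊆A B-indep

    foldr-attained : ∀ xs → foldr step 0 xs ≡ 0 ⊎
                     ∃ λ B → B ⊆ A × Indep M B × ∣ B ∣ ≡ foldr step 0 xs
    foldr-attained [] = inj₁ refl
    foldr-attained (B ∷ xs) with B ⊆? A | indep M B in B-indep
    ... | no  _   | _     = foldr-attained xs
    ... | yes _   | false = foldr-attained xs
    ... | yes B⊆A | true with ≤-total ∣ B ∣ (foldr step 0 xs)
    ... | inj₂ ∣B∣≥ = inj₂ (B , B⊆A , B-indep , sym (m≥n⇒m⊔n≡m ∣B∣≥))
    ... | inj₁ ∣B∣≤ with foldr-attained xs
    ...   | inj₁ ≡0 = inj₁ (trans (m≤n⇒m⊔n≡n ∣B∣≤) ≡0)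
    ...   | inj₂ (B′ , B′⊆A , B′-indep , ∣B′∣≡) =
            inj₂ (B′ , B′⊆A , B′-indep , trans ∣B′∣≡ (sym (m≤n⇒m⊔n≡n ∣B∣≤)))

  card≤rank : ∀ {B} → B ⊆ A → Indep M B → ∣ B ∣ ≤ rank M A
  card≤rank {B} = foldr-bound (allSubsets n) (∈allSubsets n B)

  rank-attained : rank M A ≡ 0 ⊎ ∃ (IsBasis M A)
  rank-attained = foldr-attained (allSubsets n)

  rank≤ : ∀ {k} → (∀ {B} → B ⊆ A → Indep M B → ∣ B ∣ ≤ k) → rank M A ≤ k
  rank≤ bound with rank-attained
  ... | inj₁ ≡0 = subst (_≤ _) (sym ≡0) z≤n
  ... | inj₂ (B , B⊆A , B-indep , ∣B∣≡) = subst (_≤ _) ∣B∣≡ (bound B⊆A B-indep)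

  basis : Indep M ⊥ → ∃ (IsBasis M A)
  basis ⊥-indep with rank-attained
  ... | inj₁ ≡0 = ⊥ , ⊥⊆ , ⊥-indep , trans (∣⊥∣≡0 n) (sym ≡0)
  ... | inj₂ B  = B

module MatroidProperties {M : SetSystem n} (isM : IsMatroid M) where
  open IsMatroid isM

  basisOf : ∀ X → ∃ (IsBasis M X)
  basisOf X = basis M X indep-empty

  rank-mono : ∀ {X Y} → X ⊆ Y → rank M X ≤ rank M Y
  rank-mono {X} X⊆Y with basisOf X
  ... | B , B⊆X , B-indep , ∣B∣≡ = subst (_≤ _) ∣B∣≡ (card≤rank M _ (⊆-trans B⊆X X⊆Y) B-indep)

  rank≤card : ∀ X → rank M X ≤ ∣ X ∣
  rank≤card X = rank≤ M X (λ B⊆X _ → p⊆q⇒∣p∣≤∣q∣ B⊆X)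

  indep⇒rank≡card : ∀ {X} → Indep M X → rank M X ≡ ∣ X ∣
  indep⇒rank≡card {X} X-indep = ≤-antisym (rank≤card X) (card≤rank M X ⊆-refl X-indep)

  card≤rank⇒indep : ∀ {X} → ∣ X ∣ ≤ rank M X → Indep M X
  card≤rank⇒indep {X} ∣X∣≤ with basisOf X
  ... | B , B⊆X , B-indep , ∣B∣≡ =
    indep-hered B X (p⊆q∧∣q∣≤∣p∣⇒q⊆p B⊆X (subst (∣ X ∣ ≤_) (sym ∣B∣≡) ∣X∣≤)) B-indep

  augment : ∀ {I Y} → Indep M I → ∣ I ∣ < rank M Y →
            ∃ λ z → z ∈ Y × z ∉ I × Indep M (I ∪ ⁅ z ⁆)
  augment {I} {Y} I-indep ∣I∣< with basisOf Y
  ... | B , B⊆Y , B-indep , ∣B∣≡ with indep-aug I B I-indep B-indep (subst (∣ I ∣ <_) (sym ∣B∣≡) ∣I∣<)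
  ... | z , z∈B , z∉I , I∪z-indep = z , B⊆Y z∈B , z∉I , I∪z-indep

  extend-to-basis : ∀ {I X} → Indep M I → I ⊆ X → ∃ λ J → I ⊆ J × IsBasis M X J
  extend-to-basis {I} {X} = go (rank M X) (m≤m+n (rank M X) ∣ I ∣)
    where
    go : ∀ k {I} → rank M X ≤ k + ∣ I ∣ → Indep M I → I ⊆ X → ∃ λ J → I ⊆ J × IsBasis M X J
    go k {I} bound I-indep I⊆X with ∣ I ∣ <? rank M X
    ... | no  ∣I∣≮ = I , ⊆-refl , I⊆X , I-indep , ≤-antisym (card≤rank M X I⊆X I-indep) (≮⇒≥ ∣I∣≮)
    ... | yes ∣I∣< with k | augment I-indep ∣I∣<
    ...   | zero  | _ = contradiction bound (<⇒≱ ∣I∣<)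
    ...   | suc k | z , z∈X , z∉I , I∪z-indep
          with go k (subst (rank M X ≤_)
                           (sym (trans (cong (k +_) (∣p∪⁅x⁆∣≡1+∣p∣ I z∉I)) (+-suc k ∣ I ∣)))
                           bound)
                  I∪z-indep (∪-lub I⊆X (x∈p⇒⁅x⁆⊆p z∈X))
    ...     | J , I∪z⊆J , J-basis = J , ⊆-trans (p⊆p∪q ⁅ z ⁆) I∪z⊆J , J-basis

  Spans : Subset n → Fin n → Set
  Spans X e = rank M (X ∪ ⁅ e ⁆) ≡ rank M X

  ∈⇒Spans : ∀ {X e} → e ∈ X → Spans X e
  ∈⇒Spans e∈X = cong (rank M) (x∈p⇒p∪⁅x⁆≡p e∈X)

  ¬Spans⇒rank< : ∀ {X e} → ¬ Spans X e → rank M X < rank M (X ∪ ⁅ e ⁆)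
  ¬Spans⇒rank< {e = e} ¬spans = ≤∧≢⇒< (rank-mono (p⊆p∪q ⁅ e ⁆)) (¬spans ∘ sym)

  Spans⇒basis-∪⁅⁆-dependent : ∀ {X B z} → IsBasis M X B → z ∉ B → Spans X z →
                              ¬ Indep M (B ∪ ⁅ z ⁆)
  Spans⇒basis-∪⁅⁆-dependent {X} {B} {z} (B⊆X , _ , ∣B∣≡) z∉B spans B∪z-indep =
    <-irrefl refl (begin-strict
      rank M X             ≡⟨ sym ∣B∣≡ ⟩
      ∣ B ∣                <⟨ n<1+n ∣ B ∣ ⟩
      suc ∣ B ∣            ≡⟨ sym (∣p∪⁅x⁆∣≡1+∣p∣ B z∉B) ⟩
      ∣ B ∪ ⁅ z ⁆ ∣        ≤⟨ card≤rank M _ (∪-mono B⊆X ⊆-refl) B∪z-indep ⟩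
      rank M (X ∪ ⁅ z ⁆)   ≡⟨ spans ⟩
      rank M X             ∎)
    where open ≤-Reasoning

  rank<⇒indep-∪⁅⁆ : ∀ {I X e} → Indep M I → I ⊆ X → rank M X < rank M (X ∪ ⁅ e ⁆) →
                    Indep M (I ∪ ⁅ e ⁆)
  rank<⇒indep-∪⁅⁆ {I} {X} {e} I-indep I⊆X rX< with extend-to-basis I-indep I⊆X
  ... | J , I⊆J , J-basis@(_ , J-indep , ∣J∣≡) with augment J-indep (subst (_< _) (sym ∣J∣≡) rX<)
  ... | z , z∈X∪e , z∉J , J∪z-indep with x∈p∪q⁻ X ⁅ e ⁆ z∈X∪e
  ...   | inj₁ z∈X = contradiction J∪z-indep (Spans⇒basis-∪⁅⁆-dependent J-basis z∉J (∈⇒Spans z∈X))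
  ...   | inj₂ z∈⁅e⁆ rewrite x∈⁅y⁆⇒x≡y e z∈⁅e⁆ =
          indep-hered (J ∪ ⁅ e ⁆) (I ∪ ⁅ e ⁆) (∪-mono I⊆J ⊆-refl) J∪z-indep

  Spans-mono : ∀ {C A e} → C ⊆ A → Spans C e → Spans A e
  Spans-mono {C} {A} {e} C⊆A C-spans with rank M A <? rank M (A ∪ ⁅ e ⁆)
  ... | no  rA≮ = ≤-antisym (≮⇒≥ rA≮) (rank-mono (p⊆p∪q ⁅ e ⁆))
  ... | yes rA< with basisOf C
  ... | B , B-basis@(B⊆C , B-indep , _) = contradiction
          (rank<⇒indep-∪⁅⁆ B-indep (⊆-trans B⊆C C⊆A) rA<)
          (Spans⇒basis-∪⁅⁆-dependent B-basis e∉B C-spans)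
    where
    e∉B : e ∉ B
    e∉B e∈B = <-irrefl (sym (∈⇒Spans (C⊆A (B⊆C e∈B)))) rA<

  rank-∪-spanned : ∀ {X Y} → (∀ {e} → e ∈ Y → Spans X e) → rank M (X ∪ Y) ≡ rank M X
  rank-∪-spanned {X} {Y} Y-spanned with rank M X <? rank M (X ∪ Y)
  ... | no  rX≮ = ≤-antisym (≮⇒≥ rX≮) (rank-mono (p⊆p∪q Y))
  ... | yes rX< with basisOf X
  ... | B , B-basis@(_ , B-indep , ∣B∣≡) with augment B-indep (subst (_< _) (sym ∣B∣≡) rX<)
  ... | z , z∈X∪Y , z∉B , B∪z-indep = contradiction B∪z-indep
          (Spans⇒basis-∪⁅⁆-dependent B-basis z∉B z-spanned)
    where
    z-spanned : Spans X z
    z-spanned with x∈p∪q⁻ X Y z∈X∪Y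
    ... | inj₁ z∈X = ∈⇒Spans z∈X
    ... | inj₂ z∈Y = Y-spanned z∈Y

  closure : Subset n → Subset n
  closure X = tabulate λ e → ⌊ e ∈? ground M ⌋ ∧ ⌊ rank M (X ∪ ⁅ e ⁆) ≟ rank M X ⌋

  ∈closure⇔ : ∀ {X e} → e ∈ closure X ⇔ (e ∈ ground M × Spans X e)
  ∈closure⇔ {X} {e} = ⇔.trans x∈tabulate⇔
    (⇔.trans ∧≡true⇔ (⌊⌋≡true⇔ (e ∈? ground M) ×-⇔ ⌊⌋≡true⇔ (rank M (X ∪ ⁅ e ⁆) ≟ rank M X)))

  ⊆closure : ∀ {X} → X ⊆ ground M → X ⊆ closure X
  ⊆closure X⊆E e∈X = from ∈closure⇔ (X⊆E e∈X , ∈⇒Spans e∈X)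

  rank-closure : ∀ {X} → X ⊆ ground M → rank M (closure X) ≡ rank M X
  rank-closure {X} X⊆E = ≤-antisym
    (≤-trans (rank-mono (q⊆p∪q X (closure X))) (≤-reflexive (rank-∪-spanned (proj₂ ∘ to ∈closure⇔))))
    (rank-mono (⊆closure X⊆E))

  closure-isFlat : ∀ {X} → X ⊆ ground M → IsFlat M (closure X)
  closure-isFlat {X} X⊆E = proj₁ ∘ to ∈closure⇔ , rank-grows
    where
    rank-grows : ∀ e → e ∈ ground M → e ∉ closure X → rank M (closure X) < rank M (closure X ∪ ⁅ e ⁆)
    rank-grows e e∈E e∉clX = begin-strict
      rank M (closure X)         ≡⟨ rank-closure X⊆E ⟩
      rank M X                   <⟨ ¬Spans⇒rank< (λ spans → e∉clX (from ∈closure⇔ (e∈E , spans))) ⟩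
      rank M (X ∪ ⁅ e ⁆)         ≤⟨ rank-mono (∪-mono (⊆closure X⊆E) ⊆-refl) ⟩
      rank M (closure X ∪ ⁅ e ⁆) ∎
      where open ≤-Reasoning

  dependent⇒∃circuit : ∀ {D} → D ⊆ ground M → ¬ Indep M D → ∃ λ C → C ⊆ D × IsCircuit M C
  dependent⇒∃circuit {D} = go ∣ D ∣ ≤-refl
    where
    go : ∀ k {D} → ∣ D ∣ ≤ k → D ⊆ ground M → ¬ Indep M D → ∃ λ C → C ⊆ D × IsCircuit M C
    go k {D} ∣D∣≤k D⊆E D-dep with any? (λ x → x ∈? D ×-dec ¬? (indep? M (D - x)))
    ... | no ∄x = D , ⊆-refl , D⊆E , D-dep ,
                  λ x x∈D → decidable-stable (indep? M (D - x)) (λ D-x-dep → ∄x (x , x∈D , D-x-dep))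
    ... | yes (x , x∈D , D-x-dep) with k
    ...   | zero  = contradiction ∣D∣≤k (<⇒≱ (≤-<-trans z≤n (x∈p⇒∣p-x∣<∣p∣ x∈D)))
    ...   | suc k with go k (≤-pred (≤-trans (x∈p⇒∣p-x∣<∣p∣ x∈D) ∣D∣≤k))
                          (⊆-trans (p─q⊆p D ⁅ x ⁆) D⊆E) D-x-dep
    ...     | C , C⊆D-x , C-circuit = C , ⊆-trans C⊆D-x (p─q⊆p D ⁅ x ⁆) , C-circuit

  fundamental-circuit : ∀ {X B x} → IsBasis M X B → x ∈ ground M → x ∉ B → Spans X x →
                        ∃ λ C → IsCircuit M C × x ∈ C × C ⊆ B ∪ ⁅ x ⁆
  fundamental-circuit {B = B} {x} B-basis@(_ , B-indep , _) x∈E x∉B X-spans-x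
    with dependent⇒∃circuit (∪-lub (indep⊆ground B B-indep) (x∈p⇒⁅x⁆⊆p x∈E))
                            (Spans⇒basis-∪⁅⁆-dependent B-basis x∉B X-spans-x)
  ... | C , C⊆B∪x , C-circuit@(_ , C-dep , _) = C , C-circuit , x∈C , C⊆B∪x
    where
    x∈C : x ∈ C
    x∈C = decidable-stable (x ∈? C) λ x∉C →
      C-dep (indep-hered B C (p⊆q∪⁅x⁆∧x∉p⇒p⊆q C⊆B∪x x∉C) B-indep)

  closure-isCyclicFlat : ∀ {X} → X ⊆ ground M → IsCyclic M X → IsCyclicFlat M (closure X)
  closure-isCyclicFlat {X} X⊆E X-cyclic = closure-isFlat X⊆E , closure-isCyclic
    where
    closure-isCyclic : IsCyclic M (closure X)
    closure-isCyclic x x∈clX with x ∈? X | to ∈closure⇔ x∈clX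
    ... | yes x∈X | _ with X-cyclic x x∈X
    ...   | C , C-circuit , x∈C , C⊆X = C , C-circuit , x∈C , ⊆-trans C⊆X (⊆closure X⊆E)
    closure-isCyclic x x∈clX | no x∉X | x∈E , X-spans-x with basisOf X
    ... | B , B-basis@(B⊆X , _) with fundamental-circuit B-basis x∈E (x∉X ∘ B⊆X) X-spans-x
    ... | C , C-circuit , x∈C , C⊆B∪x =
      C , C-circuit , x∈C , ⊆-trans C⊆B∪x (∪-lub (⊆-trans B⊆X (⊆closure X⊆E)) (x∈p⇒⁅x⁆⊆p x∈clX))

restrict□contract : SetSystem n → Subset n → SetSystem n
restrict□contract L S = freeProduct (restrict L S) (contract L S)

indep-restrict⇔ : ∀ (L : SetSystem n) S {A} → Indep (restrict L S) A ⇔ (A ⊆ S × Indep L A)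
indep-restrict⇔ L S {A} = ⇔.trans ∧≡true⇔ (⌊⌋≡true⇔ (A ⊆? S) ×-⇔ ⇔.refl)

indep-contract⇔ : ∀ (L : SetSystem n) S {A} →
                  Indep (contract L S) A ⇔ (A ⊆ ground L ─ S × rank L (A ∪ S) ∸ rank L S ≡ ∣ A ∣)
indep-contract⇔ L S {A} = ⇔.trans ∧≡true⇔
  (⌊⌋≡true⇔ (A ⊆? ground L ─ S) ×-⇔ ⌊⌋≡true⇔ (rank L (A ∪ S) ∸ rank L S ≟ ∣ A ∣))

indep-freeProduct⇔ : ∀ (M N : SetSystem n) {A} → Indep (freeProduct M N) A ⇔
                     (A ⊆ ground M ∪ ground N × Indep M (A ∩ ground M) ×
                      nullity N (A ∩ ground N) ≤ lam M (A ∩ ground M))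
indep-freeProduct⇔ M N {A} = ⇔.trans ∧≡true⇔ (⌊⌋≡true⇔ (A ⊆? ground M ∪ ground N) ×-⇔
  ⇔.trans ∧≡true⇔ (⇔.refl ×-⇔ ⌊⌋≡true⇔ (nullity N (A ∩ ground N) ≤? lam M (A ∩ ground M))))

module RestrictContract {L : SetSystem n} (isM : IsMatroid L) {S : Subset n} (S⊆E : S ⊆ ground L) where
  open IsMatroid isM
  open MatroidProperties isM

  rank-restrict : ∀ {X} → X ⊆ S → rank (restrict L S) X ≡ rank L X
  rank-restrict {X} X⊆S = ≤-antisym
    (rank≤ (restrict L S) X λ B⊆X B-indep →
      card≤rank L X B⊆X (proj₂ (to (indep-restrict⇔ L S) B-indep)))
    (rank≤ L X λ B⊆X B-indep →
      card≤rank (restrict L S) X B⊆X (from (indep-restrict⇔ L S) (⊆-trans B⊆X X⊆S , B-indep)))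

  rank-contract : ∀ {X} → X ⊆ ground L ─ S → rank (contract L S) X ≡ rank L (X ∪ S) ∸ rank L S
  rank-contract {X} X⊆E─S = ≤-antisym upper lower
    where
    open ≤-Reasoning
    upper : rank (contract L S) X ≤ rank L (X ∪ S) ∸ rank L S
    upper = rank≤ (contract L S) X λ {B} B⊆X B-indep → begin
      ∣ B ∣                        ≡⟨ proj₂ (to (indep-contract⇔ L S) B-indep) ⟨
      rank L (B ∪ S) ∸ rank L S    ≤⟨ ∸-monoˡ-≤ (rank L S) (rank-mono (∪-mono B⊆X ⊆-refl)) ⟩
      rank L (X ∪ S) ∸ rank L S    ∎
    lower : rank L (X ∪ S) ∸ rank L S ≤ rank (contract L S) X
    lower with basisOf S
    ... | BS , BS⊆S , BS-indep , ∣BS∣≡ with extend-to-basis BS-indep (⊆-trans BS⊆S (q⊆p∪q X S))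
    ... | J , BS⊆J , J⊆X∪S , J-indep , ∣J∣≡ = begin
      rank L (X ∪ S) ∸ rank L S  ≡⟨ ∣J─S∣≡ ⟩
      ∣ J ─ S ∣                  ≤⟨ card≤rank (contract L S) X J─S⊆X J─S-indep ⟩
      rank (contract L S) X      ∎
      where
      J─S⊆X : J ─ S ⊆ X
      J─S⊆X = p⊆q∪r⇒p─r⊆q J⊆X∪S
      J─S⊆E─S : J ─ S ⊆ ground L ─ S
      J─S⊆E─S = ⊆-trans J─S⊆X X⊆E─S
      ∣J∩S∣≡ : ∣ J ∩ S ∣ ≡ rank L S
      ∣J∩S∣≡ = ≤-antisym
        (card≤rank L S (p∩q⊆q J S) (indep-hered J (J ∩ S) (p∩q⊆p J S) J-indep))
        (subst (_≤ _) ∣BS∣≡ (p⊆q⇒∣p∣≤∣q∣ (λ x∈BS → x∈p∩q⁺ (BS⊆J x∈BS , BS⊆S x∈BS))))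
      ∣J─S∣≡ : rank L (X ∪ S) ∸ rank L S ≡ ∣ J ─ S ∣
      ∣J─S∣≡ = begin-equality
        rank L (X ∪ S) ∸ rank L S                 ≡⟨ cong₂ _∸_ (sym ∣J∣≡) (sym ∣J∩S∣≡) ⟩
        ∣ J ∣ ∸ ∣ J ∩ S ∣                          ≡⟨ cong (_∸ ∣ J ∩ S ∣) (∣p∣≡∣p∩q∣+∣p─q∣ J S) ⟩
        ∣ J ∩ S ∣ + ∣ J ─ S ∣ ∸ ∣ J ∩ S ∣            ≡⟨ m+n∸m≡n ∣ J ∩ S ∣ ∣ J ─ S ∣ ⟩
        ∣ J ─ S ∣                                 ∎
      rank[J─S∪S]≡ : rank L ((J ─ S) ∪ S) ≡ rank L (X ∪ S)
      rank[J─S∪S]≡ = ≤-antisym (rank-mono (∪-mono J─S⊆X ⊆-refl)) (begin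
        rank L (X ∪ S)       ≡⟨ ∣J∣≡ ⟨
        ∣ J ∣                ≤⟨ card≤rank L _ (p⊆p─q∪q J S) J-indep ⟩
        rank L ((J ─ S) ∪ S) ∎)
      J─S-indep : Indep (contract L S) (J ─ S)
      J─S-indep = from (indep-contract⇔ L S) (J─S⊆E─S , trans (cong (_∸ rank L S) rank[J─S∪S]≡) ∣J─S∣≡)

  nullity≤lam⇔ : ∀ {A} → A ⊆ ground L → Indep L (A ∩ S) →
                 nullity (contract L S) (A ∩ (ground L ─ S)) ≤ lam (restrict L S) (A ∩ S) ⇔
                 ∣ A ∣ ≤ rank L (A ∩ (ground L ─ S) ∪ S)
  nullity≤lam⇔ {A} A⊆E A∩S-indep
    rewrite rank-restrict {S} ⊆-refl | rank-restrict (p∩q⊆q A S) | indep⇒rank≡card A∩S-indep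
          | ∣p∣≡∣p∩q∣+∣p─q∣ A S | p⊆r⇒p─q≡p∩[r─q] S A⊆E
          | sym (m∸n+n≡m (rank-mono {S} (q⊆p∪q (A ∩ (ground L ─ S)) S)))
          | sym (rank-contract (p∩q⊆q A (ground L ─ S)))
    = ∸≤∸⇔+≤+ (card≤rank L S (p∩q⊆q A S) A∩S-indep)

  indep-restrict□contract⇔ : ∀ {A} → Indep (restrict□contract L S) A ⇔
    (A ⊆ ground L × Indep L (A ∩ S) × ∣ A ∣ ≤ rank L (A ∩ (ground L ─ S) ∪ S))
  indep-restrict□contract⇔ {A} = mk⇔ split join
    where
    S∪[E─S]≡E : S ∪ (ground L ─ S) ≡ ground L
    S∪[E─S]≡E = p⊆r⇒p∪[r─p]≡r S⊆E

    split : Indep (restrict□contract L S) A →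
            A ⊆ ground L × Indep L (A ∩ S) × ∣ A ∣ ≤ rank L (A ∩ (ground L ─ S) ∪ S)
    split A-indep with to (indep-freeProduct⇔ _ _) A-indep
    ... | A⊆S∪[E─S] , A∩S-indep′ , nullity≤lam =
      A⊆E , A∩S-indep , to (nullity≤lam⇔ A⊆E A∩S-indep) nullity≤lam
      where
      A⊆E = subst (A ⊆_) S∪[E─S]≡E A⊆S∪[E─S]
      A∩S-indep = proj₂ (to (indep-restrict⇔ L S) A∩S-indep′)

    join : A ⊆ ground L × Indep L (A ∩ S) × ∣ A ∣ ≤ rank L (A ∩ (ground L ─ S) ∪ S) →
           Indep (restrict□contract L S) A
    join (A⊆E , A∩S-indep , ∣A∣≤) = from (indep-freeProduct⇔ _ _)
      ( subst (A ⊆_) (sym S∪[E─S]≡E) A⊆E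
      , from (indep-restrict⇔ L S) (p∩q⊆q A S , A∩S-indep)
      , from (nullity≤lam⇔ A⊆E A∩S-indep) ∣A∣≤)

  indep⇒indep-restrict□contract : ∀ {A} → Indep L A → Indep (restrict□contract L S) A
  indep⇒indep-restrict□contract {A} A-indep = from indep-restrict□contract⇔
    ( A⊆E
    , indep-hered A (A ∩ S) (p∩q⊆p A S) A-indep
    , ≤-trans (card≤rank L A ⊆-refl A-indep) (rank-mono (p⊆r⇒p⊆p∩[r─q]∪q S A⊆E)))
    where
    A⊆E = indep⊆ground A A-indep

  freeSeparator⇒indep-restrict□contract⇒indep : IsFreeSeparator L S → ∀ {A} →
    Indep (restrict□contract L S) A → Indep L A
  freeSeparator⇒indep-restrict□contract⇒indep (_ , comparable) {A} A-indep′ with indep? L A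
  ... | yes A-indep = A-indep
  ... | no  A-dep with to indep-restrict□contract⇔ A-indep′
  ... | A⊆E , A∩S-indep , ∣A∣≤ with dependent⇒∃circuit A⊆E A-dep
  ... | C , C⊆A , C-circuit@(C⊆E , C-dep , _)
      with comparable (closure C) (closure-isCyclicFlat C⊆E λ x x∈C → C , C-circuit , x∈C , ⊆-refl)
  ...   | inj₁ clC⊆S = contradiction
            (indep-hered (A ∩ S) C (λ x∈C → x∈p∩q⁺ (C⊆A x∈C , clC⊆S (⊆closure C⊆E x∈C))) A∩S-indep) C-dep
  ...   | inj₂ S⊆clC = card≤rank⇒indep (begin
            ∣ A ∣                            ≤⟨ ∣A∣≤ ⟩
            rank L (A ∩ (ground L ─ S) ∪ S)  ≤⟨ rank-mono (∪-mono (p∩q⊆p A _) ⊆-refl) ⟩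
            rank L (A ∪ S)                   ≡⟨ rank-∪-spanned S-spanned ⟩
            rank L A                         ∎)
    where
    open ≤-Reasoning
    S-spanned : ∀ {e} → e ∈ S → Spans A e
    S-spanned e∈S = Spans-mono C⊆A (proj₂ (to ∈closure⇔ (S⊆clC e∈S)))

  incomparable⇒circuit-indep-in-restrict□contract : ∀ {F e f} → IsCyclicFlat L F →
    e ∈ S → e ∉ F → f ∈ F → f ∉ S → ∃ λ C → IsCircuit L C × Indep (restrict□contract L S) C
  incomparable⇒circuit-indep-in-restrict□contract {F} {e} {f} ((_ , F-flat) , F-cyclic) e∈S e∉F f∈F f∉S
    with F-cyclic f f∈F
  ... | C , C-circuit@(C⊆E , _ , C-minimal) , f∈C , C⊆F = C , C-circuit , from indep-restrict□contract⇔
    ( C⊆E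
    , indep-hered (C - f) (C ∩ S) C∩S⊆C-f C-f-indep
    , ≤-trans (≤-reflexive ∣C∣≡) (card≤rank L _ C-f∪e⊆ C-f∪e-indep))
    where
    C-f-indep = C-minimal f f∈C
    C-f⊆F : C - f ⊆ F
    C-f⊆F = ⊆-trans (p─q⊆p C ⁅ f ⁆) C⊆F
    C-f∪e-indep : Indep L ((C - f) ∪ ⁅ e ⁆)
    C-f∪e-indep = rank<⇒indep-∪⁅⁆ C-f-indep C-f⊆F (F-flat e (S⊆E e∈S) e∉F)
    C∩S⊆C-f : C ∩ S ⊆ C - f
    C∩S⊆C-f x∈C∩S = let x∈C , x∈S = x∈p∩q⁻ C S x∈C∩S in
      x∈p∧x≢y⇒x∈p-y x∈C (λ { refl → f∉S x∈S })
    C-f∪e⊆ : (C - f) ∪ ⁅ e ⁆ ⊆ C ∩ (ground L ─ S) ∪ S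
    C-f∪e⊆ = ∪-lub (⊆-trans (p─q⊆p C ⁅ f ⁆) (p⊆r⇒p⊆p∩[r─q]∪q S C⊆E))
                   (⊆-trans (x∈p⇒⁅x⁆⊆p e∈S) (q⊆p∪q _ S))
    ∣C∣≡ : ∣ C ∣ ≡ ∣ (C - f) ∪ ⁅ e ⁆ ∣
    ∣C∣≡ = trans (∣p∣≡1+∣p-x∣ C f∈C) (sym (∣p∪⁅x⁆∣≡1+∣p∣ (C - f) (e∉F ∘ C-f⊆F)))

  freeSeparator⇒≡restrict□contract : IsFreeSeparator L S → SameMatroid L (restrict□contract L S)
  freeSeparator⇒≡restrict□contract S-free = sym (p⊆r⇒p∪[r─p]≡r S⊆E) , λ _ →
    ⇔→≡ (mk⇔ indep⇒indep-restrict□contract (freeSeparator⇒indep-restrict□contract⇒indep S-free))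

  ≡restrict□contract⇒freeSeparator : SameMatroid L (restrict□contract L S) → IsFreeSeparator L S
  ≡restrict□contract⇒freeSeparator (_ , same-indep) = S⊆E , λ F F-cyclicFlat → p⊆q⊎q⊆p
    λ f∈F f∉S e∈S e∉F →
      let C , (_ , C-dep , _) , C-indep′ =
            incomparable⇒circuit-indep-in-restrict□contract F-cyclicFlat e∈S e∉F f∈F f∉S
      in C-dep (trans (same-indep C) C-indep′)

theorem6p3 : ∀ {n} (L : Matroid n) (S T : Subset n) →
    S ∩ T ≡ ⊥ → ground (proj₁ L) ≡ S ∪ T →
    (SameMatroid (proj₁ L)
       (freeProduct (restrict (proj₁ L) S) (contract (proj₁ L) S))
      → IsFreeSeparator (proj₁ L) S)
    × (IsFreeSeparator (proj₁ L) S
      → SameMatroid (proj₁ L)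
          (freeProduct (restrict (proj₁ L) S) (contract (proj₁ L) S)))
theorem6p3 (L , isM) S T _ E≡S∪T =
  ≡restrict□contract⇒freeSeparator , freeSeparator⇒≡restrict□contract
  where
  S⊆E : S ⊆ ground L
  S⊆E = subst (S ⊆_) (sym E≡S∪T) (p⊆p∪q T)
  open RestrictContract isM S⊆E
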